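{- Let $\mathcal T\in\{\mathcal T_{\rm CD},\mathcal T_{\rm CDS},\mathcal T_{\rm CDV},\mathcal T_{\rm BCD}\}$ and $\mathcal R\in\{\equiv,=_\beta,=_{\beta\eta}\}$. If $B\vdash^{\mathcal T}_{\mathcal R}\Delta:\sigma$ and $B\vdash^{\mathcal T}_{\mathcal R}\Delta:\tau$, then $\sigma\equiv\tau$ (i.e. the type of a typable $\Delta$-term in a given basis is unique).
   Context: Types: let $\mathbb A_\infty=\{a_i\mid i\in\mathbb N\}$, $\omega$ a special atom, $\mathbb A^\omega_\infty=\mathbb A_\infty\cup\{\omega\}$; types over $\mathbb A$: $\sigma::=\mathbb A\mid\sigma\to\sigma\mid\sigma\cap\sigma$. Minimal type theory: (refl) $\sigma\le\sigma$; (incl) $\sigma\cap\tau\le\sigma$, $\sigma\cap\tau\le\tau$; (glb) $\rho\le\sigma,\rho\le\tau\Rightarrow\rho\le\sigma\cap\tau$; (trans). Extras: $(\omega_{top})$ $\sigma\le\omega$; $(\omega_\to)$ $\omega\le\sigma\to\omega$; $(\to\cap)$ $(\sigma\to\tau)\cap(\sigma\to\rho)\le\sigma\to(\tau\cap\rho)$; $(\to)$ $\sigma_2\le\sigma_1,\tau_1\le\tau_2\Rightarrow\sigma_1\to\tau_1\le\sigma_2\to\tau_2$. $\mathcal T_{\rm CD}$: over $\mathbb A_\infty$, minimal only; $\mathcal T_{\rm CDS}$: over $\mathbb A^\omega_\infty$ plus $(\omega_{top})$; $\mathcal T_{\rm CDV}$: over $\mathbb A_\infty$ plus $(\to),(\to\cap)$;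 $\mathcal T_{\rm BCD}$: over $\mathbb A^\omega_\infty$ plus $(\to),(\to\cap),(\omega_{top}),(\omega_\to)$. Write $\sigma\le_{\mathcal T}\tau$. $\Delta$-terms: $\Delta::=u_\Delta\mid x\mid\lambda x{:}\sigma.\Delta\mid\Delta\,\Delta\mid\langle\Delta,\Delta\rangle\mid pr_i\Delta\mid\Delta^\sigma$, $u_\Delta$ a constant indexed by an arbitrary $\Delta$-term. Essence $\lfloor\cdot\rfloor$ (pure $\lambda$-term): $\lfloor x\rfloor=x$, $\lfloor u_\Delta\rfloor=\lfloor\Delta\rfloor$, $\lfloor\Delta^\sigma\rfloor=\lfloor\Delta\rfloor$, $\lfloor\lambda x{:}\sigma.\Delta\rfloor=\lambda x.\lfloor\Delta\rfloor$, $\lfloor\Delta_1\Delta_2\rfloor=\lfloor\Delta_1\rfloor\lfloor\Delta_2\rfloor$, $\lfloor\langle\Delta_1,\Delta_2\rangle\rfloor=\lfloor\Delta_1\rfloor$, $\lfloor pr_i\Delta\rfloor=\lfloor\Delta\rfloor$. Typed system $\Delta^{\mathcal T}_{\mathcal R}$ ($B$ a basis, $\mathbb A$ the atoms of $\mathcal T$): (top) $B\vdash u_\Delta:\omega$ if $\omega\in\mathbb A$; (ax) $B\vdash x:\sigma$ if $x{:}\sigma\in B$; ($\to I$) $B,x{:}\sigma\vdash\Delta:\tau\Rightarrow B\vdash\lambda x{:}\sigma.\Delta:\sigma\to\tau$; ($\to E$) $B\vdash\Delta_1:\sigma\to\tau$, $B\vdash\Delta_2:\sigma\Rightarrow B\vdash\Delta_1\Delta_2:\tau$;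 ($\cap I$) $B\vdash\Delta_1:\sigma$, $B\vdash\Delta_2:\tau$, $\lfloor\Delta_1\rfloor\mathcal R\lfloor\Delta_2\rfloor\Rightarrow B\vdash\langle\Delta_1,\Delta_2\rangle:\sigma\cap\tau$; ($\cap E_i$) $B\vdash\Delta:\sigma\cap\tau\Rightarrow B\vdash pr_1\Delta:\sigma$ and $B\vdash pr_2\Delta:\tau$; ($\le_{\mathcal T}$) $B\vdash\Delta:\sigma$, $\sigma\le_{\mathcal T}\tau\Rightarrow B\vdash\Delta^\tau:\tau$. -}

module Defs where

open import Data.Nat using (ℕ; zero; suc; pred; _≡ᵇ_; _<ᵇ_)
open import Data.Bool using (if_then_else_)
open import Data.List using (List; []; _∷_)
open import Data.Maybe using (Maybe; just; nothing)
open import Relation.Binary.PropositionalEquality using (_≡_)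
open import Relation.Binary.Construct.Closure.Equivalence using (EqClosure)

data Theory : Set where
  CD CDS CDV BCD : Theory

data HasΩ : Theory → Set where
  cds : HasΩ CDS
  bcd : HasΩ BCD

data HasArr : Theory → Set where
  cdv : HasArr CDV
  bcd : HasArr BCD

data HasΩArr : Theory → Set where
  bcd : HasΩArr BCD

infixr 7 _⇒_
infixl 8 _∩_
data Ty (T : Theory) : Set where
  at  : ℕ → Ty T
  ω   : HasΩ T → Ty T
  _⇒_ : Ty T → Ty T → Ty T
  _∩_ : Ty T → Ty T → Ty T

infix 4 _≤[_]_
data _≤[_]_ : {T : Theory} → Ty T → (T′ : Theory) → Ty T′ → Set where
  refl  : ∀ {T} {σ : Ty T} → σ ≤[ T ] σ
  incl₁ : ∀ {T} {σ τ : Ty T} → σ ∩ τ ≤[ T ] σ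
  incl₂ : ∀ {T} {σ τ : Ty T} → σ ∩ τ ≤[ T ] τ
  glb   : ∀ {T} {ρ σ τ : Ty T} → ρ ≤[ T ] σ → ρ ≤[ T ] τ → ρ ≤[ T ] σ ∩ τ
  trans : ∀ {T} {ρ σ τ : Ty T} → ρ ≤[ T ] σ → σ ≤[ T ] τ → ρ ≤[ T ] τ
  ωtop  : ∀ {T} {σ : Ty T} (h : HasΩ T) → σ ≤[ T ] ω h
  ω→    : ∀ {T} {σ : Ty T} (h : HasΩ T) → HasΩArr T → ω h ≤[ T ] σ ⇒ ω h
  →∩    : ∀ {T} {σ τ ρ : Ty T} → HasArr T →
          (σ ⇒ τ) ∩ (σ ⇒ ρ) ≤[ T ] σ ⇒ (τ ∩ ρ)
  arr   : ∀ {T} {σ₁ σ₂ τ₁ τ₂ : Ty T} → HasArr T →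
          σ₂ ≤[ T ] σ₁ → τ₁ ≤[ T ] τ₂ → σ₁ ⇒ τ₁ ≤[ T ] σ₂ ⇒ τ₂

data Λ : Set where
  var : ℕ → Λ
  lam : Λ → Λ
  app : Λ → Λ → Λ

shift : ℕ → Λ → Λ
shift c (var x)   = if x <ᵇ c then var x else var (suc x)
shift c (lam M)   = lam (shift (suc c) M)
shift c (app M N) = app (shift c M) (shift c N)

shiftN : ℕ → Λ → Λ
shiftN zero    M = M
shiftN (suc k) M = shift 0 (shiftN k M)

-- substitute N for variable k (under k binders), removing the binder
substAt : ℕ → Λ → Λ → Λ
substAt k N (var x)   = if x ≡ᵇ k then shiftN k N
                        else (if x <ᵇ k then var x else var (pred x))
substAt k N (lam M)   = lam (substAt (suc k) N M)
substAt k N (app M P) = app (substAt k N M) (substAt k N P)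

data Step (withη : Set) : Λ → Λ → Set where
  β     : ∀ {M N} → Step withη (app (lam M) N) (substAt 0 N M)
  η     : ∀ {M} → withη → Step withη (lam (app (shift 0 M) (var 0))) M
  ξlam  : ∀ {M M′} → Step withη M M′ → Step withη (lam M) (lam M′)
  ξappₗ : ∀ {M M′ N} → Step withη M M′ → Step withη (app M N) (app M′ N)
  ξappᵣ : ∀ {M N N′} → Step withη N N′ → Step withη (app M N) (app M N′)

data ⊤η : Set where tt : ⊤η
data ⊥η : Set where

data Rel : Set where
  syn beta betaeta : Rel

⟦_⟧ : Rel → Λ → Λ → Set
⟦ syn ⟧     = _≡_
⟦ beta ⟧    = EqClosure (Step ⊥η)
⟦ betaeta ⟧ = EqClosure (Step ⊤η)

data Δ (T : Theory) : Set where
  u    : Δ T → Δ T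
  var  : ℕ → Δ T
  lam  : Ty T → Δ T → Δ T
  app  : Δ T → Δ T → Δ T
  ⟨_,_⟩ : Δ T → Δ T → Δ T
  pr₁  : Δ T → Δ T
  pr₂  : Δ T → Δ T
  _^_  : Δ T → Ty T → Δ T

⌊_⌋ : ∀ {T} → Δ T → Λ
⌊ u D ⌋       = ⌊ D ⌋
⌊ var x ⌋     = var x
⌊ lam σ D ⌋   = lam ⌊ D ⌋
⌊ app D E ⌋   = app ⌊ D ⌋ ⌊ E ⌋
⌊ ⟨ D , E ⟩ ⌋ = ⌊ D ⌋
⌊ pr₁ D ⌋     = ⌊ D ⌋
⌊ pr₂ D ⌋     = ⌊ D ⌋
⌊ D ^ σ ⌋     = ⌊ D ⌋

lookup : ∀ {A : Set} → List A → ℕ → Maybe A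
lookup []       _       = nothing
lookup (a ∷ as) zero    = just a
lookup (a ∷ as) (suc n) = lookup as n

infix 3 _⊢[_,_]_∶_
data _⊢[_,_]_∶_ {T : Theory} (B : List (Ty T)) : (T′ : Theory) → Rel → Δ T → Ty T → Set where
  top : ∀ {R D} (h : HasΩ T) → B ⊢[ T , R ] u D ∶ ω h
  ax  : ∀ {R x σ} → lookup B x ≡ just σ → B ⊢[ T , R ] var x ∶ σ
  →I  : ∀ {R σ τ D} → _⊢[_,_]_∶_ (σ ∷ B) T R D τ → B ⊢[ T , R ] lam σ D ∶ σ ⇒ τ
  →E  : ∀ {R σ τ D E} → B ⊢[ T , R ] D ∶ σ ⇒ τ → B ⊢[ T , R ] E ∶ σ →
        B ⊢[ T , R ] app D E ∶ τ
  ∩I  : ∀ {R σ τ D E} → B ⊢[ T , R ] D ∶ σ → B ⊢[ T , R ] E ∶ τ →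
        ⟦ R ⟧ ⌊ D ⌋ ⌊ E ⌋ → B ⊢[ T , R ] ⟨ D , E ⟩ ∶ σ ∩ τ
  ∩E₁ : ∀ {R σ τ D} → B ⊢[ T , R ] D ∶ σ ∩ τ → B ⊢[ T , R ] pr₁ D ∶ σ
  ∩E₂ : ∀ {R σ τ D} → B ⊢[ T , R ] D ∶ σ ∩ τ → B ⊢[ T , R ] pr₂ D ∶ τ
  ≤T  : ∀ {R σ τ D} → B ⊢[ T , R ] D ∶ σ → σ ≤[ T ] τ → B ⊢[ T , R ] D ^ τ ∶ τ

module Submission where

-- Every term constructor is the conclusion of exactly one typing rule, and the
-- rules for λ and for coercions read the type off the annotation, so the type is
-- determined by induction on the term.

open import Defs
open import Data.List using (List)
open import Data.Maybe.Properties using (just-injective)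
open import Relation.Binary.PropositionalEquality using (_≡_; refl; sym; cong; cong₂) renaming (trans to ≡-trans)

HasΩ-irrelevant : ∀ {T} (h h′ : HasΩ T) → h ≡ h′
HasΩ-irrelevant cds cds = refl
HasΩ-irrelevant bcd bcd = refl

module _ {T : Theory} {σ₁ σ₂ τ₁ τ₂ : Ty T} where

  ⇒-injectiveʳ : σ₁ ⇒ τ₁ ≡ σ₂ ⇒ τ₂ → τ₁ ≡ τ₂
  ⇒-injectiveʳ refl = refl

  ∩-injectiveˡ : σ₁ ∩ τ₁ ≡ σ₂ ∩ τ₂ → σ₁ ≡ σ₂
  ∩-injectiveˡ refl = refl

  ∩-injectiveʳ : σ₁ ∩ τ₁ ≡ σ₂ ∩ τ₂ → τ₁ ≡ τ₂
  ∩-injectiveʳ refl = refl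

⊢-type-unique : ∀ {T R R′} {B : List (Ty T)} {D : Δ T} {σ τ : Ty T} →
                B ⊢[ T , R ] D ∶ σ → B ⊢[ T , R′ ] D ∶ τ → σ ≡ τ
⊢-type-unique (top h)      (top h′)     = cong ω (HasΩ-irrelevant h h′)
⊢-type-unique (ax p)       (ax q)       = just-injective (≡-trans (sym p) q)
⊢-type-unique (→I d)       (→I e)       = cong (_ ⇒_) (⊢-type-unique d e)
⊢-type-unique (→E d _)     (→E e _)     = ⇒-injectiveʳ (⊢-type-unique d e)
⊢-type-unique (∩I d₁ d₂ _) (∩I e₁ e₂ _) = cong₂ _∩_ (⊢-type-unique d₁ e₁) (⊢-type-unique d₂ e₂)
⊢-type-unique (∩E₁ d)      (∩E₁ e)      = ∩-injectiveˡ (⊢-type-unique d e)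
⊢-type-unique (∩E₂ d)      (∩E₂ e)      = ∩-injectiveʳ (⊢-type-unique d e)
⊢-type-unique (≤T _ _)     (≤T _ _)     = refl

lemma4p5 : (T : Theory) (R : Rel) (B : List (Ty T)) (D : Δ T) (σ τ : Ty T) →
    B ⊢[ T , R ] D ∶ σ → B ⊢[ T , R ] D ∶ τ → σ ≡ τ
lemma4p5 T R B D σ τ = ⊢-type-unique
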